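{- Let $G$ be a finite group with $|\pi(Z(G))|\geq 2$. Then the deleted enhanced power graph $\mathcal{G}^*_e(G)$ is connected.
   Context: For a group $G$, the enhanced power graph $\mathcal{G}_e(G)$ is the simple undirected graph with vertex set $G$ in which two distinct vertices $x,y$ are adjacent if there exists $z\in G$ with $x=z^m$ and $y=z^n$ for some $m,n\in\mathbb{N}$. The deleted enhanced power graph $\mathcal{G}^*_e(G)$ is the induced subgraph of $\mathcal{G}_e(G)$ on $G\setminus\{e\}$. $Z(G)$ is the center of $G$, and for a finite group $H$, $\pi(H)$ is the set of primes dividing $|H|$. -}

module Defs where

open import Data.Nat using (ℕ; zero; suc)
open import Data.Fin using (Fin)
open import Data.Fin.Properties using (_≟_; all?)
open import Data.List using (List; length; filter)
open import Data.List.Base using (allFin)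
open import Data.Product using (Σ; ∃; _×_; _,_)
open import Data.Nat.Divisibility using (_∣_)
open import Data.Nat.Primality using (Prime)
open import Relation.Nullary using (¬_; Dec)
open import Relation.Binary.PropositionalEquality using (_≡_; _≢_)
open import Algebra.Structures using (IsGroup)

-- A finite group: a group whose underlying set is Fin order
-- (every finite group is isomorphic to one of this form).
record FiniteGroup : Set where
  field
    order : ℕ
    _∙_   : Fin order → Fin order → Fin order
    ε     : Fin order
    _⁻¹   : Fin order → Fin order
    isGroup : IsGroup _≡_ _∙_ ε _⁻¹

module _ (G : FiniteGroup) where
  open FiniteGroup G

  El : Set
  El = Fin order

  pow : El → ℕ → El
  pow z zero    = ε
  pow z (suc m) = z ∙ pow z m

  IsCentral : El → Set
  IsCentral z = ∀ g → z ∙ g ≡ g ∙ z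

  isCentral? : (z : El) → Dec (IsCentral z)
  isCentral? z = all? (λ g → (z ∙ g) ≟ (g ∙ z))

  centerList : List El
  centerList = filter isCentral? (allFin order)

  centerOrder : ℕ
  centerOrder = length centerList

  AtLeastTwoPrimesDivCenter : Set
  AtLeastTwoPrimesDivCenter =
    Σ ℕ λ p → Σ ℕ λ q → Prime p × Prime q × p ≢ q × p ∣ centerOrder × q ∣ centerOrder

  -- adjacency in the enhanced power graph (exponents m, n ∈ ℕ = {1,2,...})
  EPAdj : El → El → Set
  EPAdj x y = x ≢ y × Σ El λ z → Σ ℕ λ m → Σ ℕ λ n →
                x ≡ pow z (suc m) × y ≡ pow z (suc n)

  DelAdj : El → El → Set
  DelAdj x y = x ≢ ε × y ≢ ε × EPAdj x y

  data DelReach (x : El) : El → Set where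
    here  : DelReach x x
    there : ∀ {y w} → DelReach x y → DelAdj y w → DelReach x w

  DeletedEPGConnected : Set
  DeletedEPGConnected = ∀ x y → x ≢ ε → y ≢ ε → DelReach x y

-- Cauchy's theorem, proved by McKay's counting argument and applied to Z(G), gives
-- central elements a and b of distinct prime orders p and q.  Two commuting
-- nontrivial elements of distinct prime orders are adjacent, since both are powers
-- of their product.  Every x ≠ e has a power y of prime order r, adjacent to x (or
-- equal to it); y commutes with a and b, and r differs from p or from q, so y is
-- joined to a either directly or through b.

module Submission where

open import Defs

open import Algebra.Bundles using (Group; Monoid)
open import Algebra.Structures using (IsGroup)
open import Data.Empty using (⊥-elim)
open import Data.Fin using (toℕ)
open import Data.Fin.Properties using (pigeonhole) renaming (_≟_ to _≟ᶠ_)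
open import Data.List using (List; []; _∷_; [_]; _++_; map; foldr; length; filter; replicate; applyUpTo; allFin; cartesianProductWith)
open import Data.List.Membership.Propositional using (_∈_)
open import Data.List.Membership.Propositional.Properties
  using (∈-filter⁺; ∈-filter⁻; ∈-length; ∈-applyUpTo⁺; ∈-applyUpTo⁻; ∈-allFin; ∈-cartesianProductWith⁺; ∈-cartesianProductWith⁻)
open import Data.List.Membership.Propositional.Properties.WithK using (unique∧set⇒bag)
open import Data.List.Properties using (length-replicate; length-++; length-map; length-applyUpTo; ∷-injective; ∷-injectiveˡ; ++-assoc; ++-identityʳ; ∷ʳ-injectiveˡ; ≡-dec)
open import Data.List.Relation.Binary.BagAndSetEquality using (∼bag⇒↭)
open import Data.List.Relation.Binary.Permutation.Propositional.Properties using (↭-length)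
open import Data.List.Relation.Unary.All as All using (All; []; _∷_)
import Data.List.Relation.Unary.All.Properties as All
open import Data.List.Relation.Unary.Any using (here; there)
open import Data.List.Relation.Unary.Unique.Propositional using (Unique; []; _∷_)
import Data.List.Relation.Unary.Unique.Propositional.Properties as Unique
open import Data.Nat using (ℕ; zero; suc; pred; nonTrivial⇒n>1; >-nonZero; >-nonZero⁻¹; _+_; _*_; _^_; _∸_; _≤_; _<_; s≤s; z≤n; NonZero)
open import Data.Nat.Coprimality using (Coprime; coprime-Bézout; prime⇒coprime)
open import Data.Nat.Divisibility using (_∣_; _∣0; ∣-refl; ∣-trans; ∣m∣n⇒∣m+n; ∣m+n∣m⇒∣n; ∣⇒≤; m∣m*n)
open import Data.Nat.DivMod using (_%_; _/_; m≡m%n+[m/n]*n; m%n<n)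
open import Data.Nat.GCD using (module Bézout)
open import Data.Nat.GeneralisedArithmetic using (fold; fold-+)
open import Data.Nat.Primality.Factorisation using (PrimeFactorisation; factorise)
open import Data.Nat.Primality using (Prime; prime⇒nonZero; prime⇒nonTrivial; prime⇒irreducible; ¬prime[0]; ¬prime[1])
open import Data.Nat.ListAction using (product)
open import Data.Nat.Properties
open import Data.Nat.Tactic.RingSolver using (solve-∀)
open import Data.Product using (∃; ∃₂; _×_; _,_; proj₁; proj₂)
open import Data.Sum using (inj₁; inj₂)
open import Function.Bundles using (mk⇔)
open import Level using (0ℓ)
open import Relation.Binary.Definitions using (DecidableEquality)
open import Relation.Binary.PropositionalEquality hiding ([_])
open import Relation.Nullary using (¬_; yes; no; ¬?)
open import Relation.Unary using (Pred; Decidable)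

module _ {A : Set} where

  length-unique-≡ : {xs ys : List A} → Unique xs → Unique ys →
                    (∀ {x} → x ∈ xs → x ∈ ys) → (∀ {x} → x ∈ ys → x ∈ xs) →
                    length xs ≡ length ys
  length-unique-≡ xs! ys! xs⊆ys ys⊆xs =
    ↭-length (∼bag⇒↭ (unique∧set⇒bag xs! ys! (mk⇔ xs⊆ys ys⊆xs)))

  replicate-∷ʳ : ∀ n (x : A) → replicate n x ++ [ x ] ≡ x ∷ replicate n x
  replicate-∷ʳ zero    x = refl
  replicate-∷ʳ (suc n) x = cong (x ∷_) (replicate-∷ʳ n x)

  ∷ʳ≡∷⇒replicate : ∀ {x y : A} xs → xs ++ [ y ] ≡ x ∷ xs → xs ≡ replicate (length xs) x × y ≡ x
  ∷ʳ≡∷⇒replicate []       eq = refl , ∷-injectiveˡ eq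
  ∷ʳ≡∷⇒replicate (z ∷ xs) eq with ∷-injective eq
  ... | refl , eq′ with ∷ʳ≡∷⇒replicate xs eq′
  ...   | xs≡ , y≡z = cong (z ∷_) xs≡ , y≡z

  unique-∃≢ : ∀ {xs : List A} {a} → Unique xs → a ∈ xs → 2 ≤ length xs → ∃ λ b → b ∈ xs × b ≢ a
  unique-∃≢ {b ∷ c ∷ _} ((b≢c ∷ _) ∷ _) (here refl) _ = c , there (here refl) , λ c≡b → b≢c (sym c≡b)
  unique-∃≢ {b ∷ _ ∷ _} (b≢tail ∷ _) (there a∈tail) _ = b , here refl , All.lookup b≢tail a∈tail
  unique-∃≢ {_ ∷ []} _ _ (s≤s ())

  length-filter+length-filter-∁ : {P : Pred A 0ℓ} (P? : Decidable P) (xs : List A) →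
    length (filter P? xs) + length (filter (λ x → ¬? (P? x)) xs) ≡ length xs
  length-filter+length-filter-∁ P? [] = refl
  length-filter+length-filter-∁ P? (x ∷ xs) with P? x
  ... | yes _ = cong suc (length-filter+length-filter-∁ P? xs)
  ... | no _  = trans (+-suc _ _) (cong suc (length-filter+length-filter-∁ P? xs))

  length-cartesianProductWith : ∀ {B C : Set} (f : A → B → C) xs ys →
                                length (cartesianProductWith f xs ys) ≡ length xs * length ys
  length-cartesianProductWith f []       ys = refl
  length-cartesianProductWith f (x ∷ xs) ys = begin
    length (map (f x) ys ++ cartesianProductWith f xs ys)         ≡⟨ length-++ (map (f x) ys) ⟩
    length (map (f x) ys) + length (cartesianProductWith f xs ys) ≡⟨ cong₂ _+_ (length-map (f x) ys) (length-cartesianProductWith f xs ys) ⟩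
    length ys + length xs * length ys                             ∎
    where open ≡-Reasoning

  tuples : List A → ℕ → List (List A)
  tuples xs zero    = [ [] ]
  tuples xs (suc k) = cartesianProductWith _∷_ xs (tuples xs k)

  length-tuples : ∀ xs k → length (tuples xs k) ≡ length xs ^ k
  length-tuples xs zero    = refl
  length-tuples xs (suc k) = trans (length-cartesianProductWith _∷_ xs (tuples xs k)) (cong (length xs *_) (length-tuples xs k))

  tuples-unique : ∀ {xs} → Unique xs → ∀ k → Unique (tuples xs k)
  tuples-unique xs! zero    = [] ∷ []
  tuples-unique xs! (suc k) = Unique.cartesianProductWith⁺ _∷_ ∷-injective xs! (tuples-unique xs! k)

  ∈-tuples⁺ : ∀ {xs l} → All (_∈ xs) l → l ∈ tuples xs (length l)
  ∈-tuples⁺ []           = here refl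
  ∈-tuples⁺ (x∈ ∷ l∈)    = ∈-cartesianProductWith⁺ _∷_ x∈ (∈-tuples⁺ l∈)

  ∈-tuples⁻ : ∀ {xs} k {l} → l ∈ tuples xs k → length l ≡ k × All (_∈ xs) l
  ∈-tuples⁻ zero    (here refl) = refl , []
  ∈-tuples⁻ {xs} (suc k) l∈ with ∈-cartesianProductWith⁻ _∷_ xs (tuples xs k) l∈
  ... | x , l′ , x∈ , l′∈ , refl with ∈-tuples⁻ k l′∈
  ...   | refl , l′⊆xs = refl , x∈ ∷ l′⊆xs

module _ {A : Set} (σ : A → A) where

  fold-σ : ∀ n x → fold (σ x) σ n ≡ fold x σ (suc n)
  fold-σ zero    x = refl
  fold-σ (suc n) x = cong σ (fold-σ n x)

  fold-multiple : ∀ {x} n k → fold x σ n ≡ x → fold x σ (k * n) ≡ x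
  fold-multiple n zero    eq = refl
  fold-multiple {x} n (suc k) eq = begin
    fold x σ (n + k * n)         ≡⟨ fold-+ x σ n ⟩
    fold (fold x σ (k * n)) σ n  ≡⟨ cong (λ y → fold y σ n) (fold-multiple n k eq) ⟩
    fold x σ n                   ≡⟨ eq ⟩
    x                            ∎
    where open ≡-Reasoning

  fold-fixed : ∀ {x} n → σ x ≡ x → fold x σ n ≡ x
  fold-fixed zero    eq = refl
  fold-fixed (suc n) eq = trans (cong σ (fold-fixed n eq)) eq

module _ {A : Set} where

  rotate : List A → List A
  rotate []       = []
  rotate (x ∷ xs) = xs ++ [ x ]

  fold-rotate-++ : ∀ (xs ys : List A) → fold (xs ++ ys) rotate (length xs) ≡ ys ++ xs
  fold-rotate-++ []       ys = sym (++-identityʳ ys)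
  fold-rotate-++ (x ∷ xs) ys = begin
    fold (x ∷ xs ++ ys) rotate (suc (length xs))  ≡˘⟨ fold-σ rotate (length xs) (x ∷ xs ++ ys) ⟩
    fold ((xs ++ ys) ++ [ x ]) rotate (length xs) ≡⟨ cong (λ zs → fold zs rotate (length xs)) (++-assoc xs ys [ x ]) ⟩
    fold (xs ++ ys ++ [ x ]) rotate (length xs)   ≡⟨ fold-rotate-++ xs (ys ++ [ x ]) ⟩
    (ys ++ [ x ]) ++ xs                           ≡⟨ ++-assoc ys [ x ] xs ⟩
    ys ++ x ∷ xs                                  ∎
    where open ≡-Reasoning

  fold-rotate-length : ∀ (xs : List A) → fold xs rotate (length xs) ≡ xs
  fold-rotate-length xs = trans (cong (λ ys → fold ys rotate (length xs)) (sym (++-identityʳ xs))) (fold-rotate-++ xs [])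

module FixedPoints {A : Set} (_≟_ : DecidableEquality A) (σ : A → A) {p : ℕ} (p-prime : Prime p) where

  private instance
    p≢0 : NonZero p
    p≢0 = prime⇒nonZero p-prime

  open import Data.List.Membership.DecPropositional _≟_ using (_∈?_)

  Periodic : A → Set
  Periodic x = fold x σ p ≡ x

  Closed : List A → Set
  Closed xs = ∀ {x} → x ∈ xs → σ x ∈ xs

  fixed? : Decidable (λ x → σ x ≡ x)
  fixed? x = σ x ≟ x

  σ⁻¹-σ : ∀ {x} → Periodic x → fold (σ x) σ (pred p) ≡ x
  σ⁻¹-σ {x} per = trans (trans (fold-σ σ (pred p) x) (cong (fold x σ) (suc-pred p))) per

  fold-mod : ∀ {x} → Periodic x → ∀ n → fold x σ n ≡ fold x σ (n % p)
  fold-mod {x} per n = begin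
    fold x σ n                                   ≡⟨ cong (fold x σ) (m≡m%n+[m/n]*n n p) ⟩
    fold x σ (n % p + n / p * p)                 ≡⟨ fold-+ x σ (n % p) ⟩
    fold (fold x σ (n / p * p)) σ (n % p)        ≡⟨ cong (λ y → fold y σ (n % p)) (fold-multiple σ p (n / p) per) ⟩
    fold x σ (n % p)                             ∎
    where open ≡-Reasoning

  -- d and p are coprime, so the period 1 is a Bézout combination of d and p.
  fixed-of-period : ∀ {x} d → Periodic x → 0 < d → d < p → fold x σ d ≡ x → σ x ≡ x
  fixed-of-period {x} d@(suc _) per _ d<p eq with coprime-Bézout (prime⇒coprime p-prime d<p)
  ... | Bézout.+- a b 1+bd≡ap = begin
    σ x                   ≡˘⟨ cong σ (fold-multiple σ d b eq) ⟩
    fold x σ (1 + b * d)  ≡⟨ cong (fold x σ) 1+bd≡ap ⟩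
    fold x σ (a * p)      ≡⟨ fold-multiple σ p a per ⟩
    x                     ∎
    where open ≡-Reasoning
  ... | Bézout.-+ a b 1+ap≡bd = begin
    σ x                   ≡˘⟨ cong σ (fold-multiple σ p a per) ⟩
    fold x σ (1 + a * p)  ≡⟨ cong (fold x σ) 1+ap≡bd ⟩
    fold x σ (b * d)      ≡⟨ fold-multiple σ d b eq ⟩
    x                     ∎
    where open ≡-Reasoning

  orbit : A → List A
  orbit x = applyUpTo (fold x σ) p

  ∈-orbit : ∀ {x} → Periodic x → ∀ n → fold x σ n ∈ orbit x
  ∈-orbit per n = subst (_∈ orbit _) (sym (fold-mod per n)) (∈-applyUpTo⁺ (fold _ σ) (m%n<n n p))

  orbit-unique : ∀ {x} → Periodic x → σ x ≢ x → Unique (orbit x)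
  orbit-unique {x} per nonfixed = Unique.applyUpTo⁺₁ (fold x σ) p distinct
    where
    -- Applying σ^(p - j) to σ^i x = σ^j x gives x = σ^(p - j + i) x, and 0 < p - j + i < p.
    distinct : ∀ {i j} → i < j → j < p → fold x σ i ≢ fold x σ j
    distinct {i} {j} i<j j<p eq = nonfixed (fixed-of-period (p ∸ j + i) per 0<d d<p (begin
      fold x σ (p ∸ j + i)          ≡⟨ fold-+ x σ (p ∸ j) ⟩
      fold (fold x σ i) σ (p ∸ j)   ≡⟨ cong (λ y → fold y σ (p ∸ j)) eq ⟩
      fold (fold x σ j) σ (p ∸ j)   ≡˘⟨ fold-+ x σ (p ∸ j) ⟩
      fold x σ (p ∸ j + j)          ≡⟨ cong (fold x σ) (m∸n+n≡m (<⇒≤ j<p)) ⟩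
      fold x σ p                    ≡⟨ per ⟩
      x                             ∎))
      where
      open ≡-Reasoning
      0<d : 0 < p ∸ j + i
      0<d = ≤-trans (m<n⇒0<n∸m j<p) (m≤m+n (p ∸ j) i)
      d<p : p ∸ j + i < p
      d<p = subst (p ∸ j + i <_) (m∸n+n≡m (<⇒≤ j<p)) (+-monoʳ-< (p ∸ j) i<j)

  orbit-⊆ : ∀ {xs x y} → Closed xs → x ∈ xs → y ∈ orbit x → y ∈ xs
  orbit-⊆ {xs} closed x∈xs y∈orbit with ∈-applyUpTo⁻ _ y∈orbit
  ... | i , _ , refl = fold-∈ i
    where
    fold-∈ : ∀ n → fold _ σ n ∈ xs
    fold-∈ zero    = x∈xs
    fold-∈ (suc n) = closed (fold-∈ n)

  σ-∈-orbit⁻ : ∀ {x y} → Periodic x → Periodic y → σ y ∈ orbit x → y ∈ orbit x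
  σ-∈-orbit⁻ {x} {y} perx pery σy∈orbit with ∈-applyUpTo⁻ _ σy∈orbit
  ... | i , _ , σy≡ = subst (_∈ orbit x) y≡ (∈-orbit perx (pred p + i))
    where
    y≡ : fold x σ (pred p + i) ≡ y
    y≡ = begin
      fold x σ (pred p + i)          ≡⟨ fold-+ x σ (pred p) ⟩
      fold (fold x σ i) σ (pred p)   ≡˘⟨ cong (λ z → fold z σ (pred p)) σy≡ ⟩
      fold (σ y) σ (pred p)          ≡⟨ σ⁻¹-σ pery ⟩
      y                              ∎
      where open ≡-Reasoning

  AllPeriodic : List A → Set
  AllPeriodic xs = ∀ {x} → x ∈ xs → Periodic x

  -- The orbit of the head consists of exactly p elements of xs; remove it and recurse.
  p∣length-fixedPointFree : ∀ n xs → length xs ≤ n → Unique xs → Closed xs → AllPeriodic xs →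
                            (∀ {x} → x ∈ xs → σ x ≢ x) → p ∣ length xs
  p∣length-fixedPointFree n       []       _   _   _      _   _        = p ∣0
  p∣length-fixedPointFree (suc n) (x ∷ xs) len xs! closed per nonfixed =
    subst (p ∣_) split (∣m∣n⇒∣m+n ∣-refl
      (p∣length-fixedPointFree n rest rest-length (Unique.filter⁺ outside? xs!) rest-closed
        (λ y∈rest → per (proj₁ (∈-filter⁻ outside? y∈rest)))
        (λ y∈rest → nonfixed (proj₁ (∈-filter⁻ outside? y∈rest)))))
    where
    x∈xs : x ∈ x ∷ xs
    x∈xs = here refl
    outside? : Decidable (λ y → ¬ y ∈ orbit x)
    outside? y = ¬? (y ∈? orbit x)
    rest : List A
    rest = filter outside? (x ∷ xs)
    length-inside : length (filter (_∈? orbit x) (x ∷ xs)) ≡ p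
    length-inside = trans
      (length-unique-≡ (Unique.filter⁺ (_∈? orbit x) xs!) (orbit-unique (per x∈xs) (nonfixed x∈xs))
        (λ y∈ → proj₂ (∈-filter⁻ (_∈? orbit x) y∈))
        (λ y∈orbit → ∈-filter⁺ (_∈? orbit x) (orbit-⊆ closed x∈xs y∈orbit) y∈orbit))
      (length-applyUpTo (fold x σ) p)
    split : p + length rest ≡ length (x ∷ xs)
    split = trans (cong (_+ length rest) (sym length-inside))
                  (length-filter+length-filter-∁ (_∈? orbit x) (x ∷ xs))
    rest-length : length rest ≤ n
    rest-length = ≤-pred (≤-trans (+-monoˡ-≤ (length rest) (>-nonZero⁻¹ p)) (subst (_≤ suc n) (sym split) len))
    rest-closed : Closed rest
    rest-closed y∈rest with ∈-filter⁻ outside? y∈rest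
    ... | y∈xs , y∉orbit =
      ∈-filter⁺ outside? (closed y∈xs) (λ σy∈orbit → y∉orbit (σ-∈-orbit⁻ (per x∈xs) (per y∈xs) σy∈orbit))

  p∣length-fixedPoints : ∀ {xs} → Unique xs → Closed xs → AllPeriodic xs →
                         p ∣ length xs → p ∣ length (filter fixed? xs)
  p∣length-fixedPoints {xs} xs! closed per p∣xs = ∣m+n∣m⇒∣n
    (subst (p ∣_) (sym (trans (+-comm (length moving) _) (length-filter+length-filter-∁ fixed? xs))) p∣xs)
    (p∣length-fixedPointFree (length moving) moving ≤-refl (Unique.filter⁺ moving? {xs} xs!) moving-closed
      (λ y∈ → per (proj₁ (∈-filter⁻ moving? {xs = xs} y∈)))
      (λ y∈ → proj₂ (∈-filter⁻ moving? {xs = xs} y∈)))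
    where
    moving? : Decidable (λ y → σ y ≢ y)
    moving? y = ¬? (fixed? y)
    moving : List A
    moving = filter moving? xs
    moving-closed : Closed moving
    moving-closed y∈ with ∈-filter⁻ moving? y∈
    ... | y∈xs , σy≢y = ∈-filter⁺ moving? (closed y∈xs)
      (λ σσy≡σy → σy≢y (sym (trans (sym (σ⁻¹-σ (per y∈xs))) (fold-fixed σ (pred p) σσy≡σy))))

distinctPrimes-coprime : ∀ {p q} → Prime p → Prime q → p ≢ q → Coprime p q
distinctPrimes-coprime p-prime q-prime p≢q (d∣p , d∣q) with prime⇒irreducible p-prime d∣p
... | inj₁ d≡1 = d≡1
... | inj₂ refl with prime⇒irreducible q-prime d∣q
...   | inj₁ p≡1 = ⊥-elim (¬prime[1] (subst Prime p≡1 p-prime))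
...   | inj₂ p≡q = ⊥-elim (p≢q p≡q)

-- Multiplying 1 + b n = a m by m - 1 gives 1 + ((m - 1) a - 1) m = (m - 1) b n.
bézout-flip : ∀ {a b m n} → 2 ≤ m → 1 + b * n ≡ a * m → ∃₂ λ j k → 1 + j * m ≡ k * n
bézout-flip {m = 1}  (s≤s ())
bézout-flip {zero}   {b} {suc (suc m₀)}     _ ()
bézout-flip {suc a₀} {b} {m@(suc (suc m₀))} {n} _ eq =
  suc m₀ * a₀ + m₀ , b * suc m₀ , +-cancelʳ-≡ (suc m₀) _ _ (begin
    1 + (suc m₀ * a₀ + m₀) * m + suc m₀  ≡⟨ lhs m₀ a₀ ⟩
    suc m₀ * (suc a₀ * m)                ≡˘⟨ cong (suc m₀ *_) eq ⟩
    suc m₀ * (1 + b * n)                 ≡⟨ rhs m₀ b n ⟩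
    b * suc m₀ * n + suc m₀              ∎)
  where
  open ≡-Reasoning
  lhs : ∀ m₀ a₀ → 1 + (suc m₀ * a₀ + m₀) * suc (suc m₀) + suc m₀ ≡ suc m₀ * (suc a₀ * suc (suc m₀))
  lhs = solve-∀
  rhs : ∀ m₀ b n → suc m₀ * (1 + b * n) ≡ b * suc m₀ * n + suc m₀
  rhs = solve-∀

distinctPrimes-bézout : ∀ {p q} → Prime p → Prime q → p ≢ q → ∃₂ λ j k → 1 + j * p ≡ k * q
distinctPrimes-bézout {p} p-prime q-prime p≢q with coprime-Bézout (distinctPrimes-coprime p-prime q-prime p≢q)
... | Bézout.-+ j k 1+jp≡kq = j , k , 1+jp≡kq
... | Bézout.+- a b 1+bq≡ap = bézout-flip {a} {b} (nonTrivial⇒n>1 p ⦃ prime⇒nonTrivial p-prime ⦄) 1+bq≡ap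

module _ (G : FiniteGroup) where

  open FiniteGroup G
  open IsGroup isGroup using (assoc; identityˡ; identityʳ; inverseˡ; inverseʳ; isMonoid)

  private
    group : Group 0ℓ 0ℓ
    group = record { isGroup = isGroup }

    monoid : Monoid 0ℓ 0ℓ
    monoid = record { isMonoid = isMonoid }

  open import Algebra.Properties.Group group using (ε⁻¹≈ε; ⁻¹-anti-homo-∙; ⁻¹-involutive; identityʳ-unique)
  open import Algebra.Properties.Monoid.Mult monoid using (×-homo-+; ×-assocˡ) renaming (_×_ to _·_)

  pow≡· : ∀ x n → pow G x n ≡ n · x
  pow≡· x zero    = refl
  pow≡· x (suc n) = cong (x ∙_) (pow≡· x n)

  pow-+ : ∀ x m n → pow G x (m + n) ≡ pow G x m ∙ pow G x n
  pow-+ x m n = begin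
    pow G x (m + n)          ≡⟨ pow≡· x (m + n) ⟩
    (m + n) · x              ≡⟨ ×-homo-+ x m n ⟩
    (m · x) ∙ (n · x)        ≡˘⟨ cong₂ _∙_ (pow≡· x m) (pow≡· x n) ⟩
    pow G x m ∙ pow G x n    ∎
    where open ≡-Reasoning

  pow-* : ∀ x m n → pow G (pow G x n) m ≡ pow G x (m * n)
  pow-* x m n = begin
    pow G (pow G x n) m   ≡⟨ pow≡· (pow G x n) m ⟩
    m · pow G x n         ≡⟨ cong (m ·_) (pow≡· x n) ⟩
    m · (n · x)           ≡⟨ ×-assocˡ x m n ⟩
    (m * n) · x           ≡˘⟨ pow≡· x (m * n) ⟩
    pow G x (m * n)       ∎
    where open ≡-Reasoning

  pow-ε : ∀ n → pow G ε n ≡ ε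
  pow-ε zero    = refl
  pow-ε (suc n) = trans (cong (ε ∙_) (pow-ε n)) (identityˡ ε)

  pow-multiple : ∀ {x m} k → pow G x m ≡ ε → pow G x (k * m) ≡ ε
  pow-multiple {x} {m} k eq = trans (sym (pow-* x k m)) (trans (cong (λ y → pow G y k) eq) (pow-ε k))

  pow-1+multiple : ∀ {x m} k → pow G x m ≡ ε → pow G x (1 + k * m) ≡ x
  pow-1+multiple {x} k eq = trans (cong (x ∙_) (pow-multiple k eq)) (identityʳ x)

  ∙-pow-comm : ∀ {x y} n → x ∙ y ≡ y ∙ x → x ∙ pow G y n ≡ pow G y n ∙ x
  ∙-pow-comm {x} zero    _    = trans (identityʳ x) (sym (identityˡ x))
  ∙-pow-comm {x} {y} (suc n) comm = begin
    x ∙ (y ∙ pow G y n)   ≡˘⟨ assoc x y _ ⟩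
    (x ∙ y) ∙ pow G y n   ≡⟨ cong (_∙ pow G y n) comm ⟩
    (y ∙ x) ∙ pow G y n   ≡⟨ assoc y x _ ⟩
    y ∙ (x ∙ pow G y n)   ≡⟨ cong (y ∙_) (∙-pow-comm n comm) ⟩
    y ∙ (pow G y n ∙ x)   ≡˘⟨ assoc y _ x ⟩
    (y ∙ pow G y n) ∙ x   ∎
    where open ≡-Reasoning

  pow-∙ : ∀ {x y} n → x ∙ y ≡ y ∙ x → pow G (x ∙ y) n ≡ pow G x n ∙ pow G y n
  pow-∙ zero    _ = sym (identityˡ ε)
  pow-∙ {x} {y} (suc n) comm = begin
    (x ∙ y) ∙ pow G (x ∙ y) n             ≡⟨ cong ((x ∙ y) ∙_) (pow-∙ n comm) ⟩
    (x ∙ y) ∙ (pow G x n ∙ pow G y n)     ≡⟨ assoc x y _ ⟩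
    x ∙ (y ∙ (pow G x n ∙ pow G y n))     ≡˘⟨ cong (x ∙_) (assoc y _ _) ⟩
    x ∙ ((y ∙ pow G x n) ∙ pow G y n)     ≡⟨ cong (λ z → x ∙ (z ∙ pow G y n)) (∙-pow-comm n (sym comm)) ⟩
    x ∙ ((pow G x n ∙ y) ∙ pow G y n)     ≡⟨ cong (x ∙_) (assoc _ y _) ⟩
    x ∙ (pow G x n ∙ (y ∙ pow G y n))     ≡˘⟨ assoc x _ _ ⟩
    (x ∙ pow G x n) ∙ (y ∙ pow G y n)     ∎
    where open ≡-Reasoning

  prod : List (El G) → El G
  prod = foldr _∙_ ε

  prod-++ : ∀ xs ys → prod (xs ++ ys) ≡ prod xs ∙ prod ys
  prod-++ []       ys = sym (identityˡ _)
  prod-++ (x ∷ xs) ys = trans (cong (x ∙_) (prod-++ xs ys)) (sym (assoc x _ _))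

  prod-replicate : ∀ n x → prod (replicate n x) ≡ pow G x n
  prod-replicate zero    x = refl
  prod-replicate (suc n) x = cong (x ∙_) (prod-replicate n x)

  -- Appending the inverse of the product turns a k-tuple into a (k+1)-tuple with
  -- product ε; under this completion McKay's shift becomes rotation, so shift^(k+1) = id.
  shift : List (El G) → List (El G)
  shift []       = []
  shift (x ∷ xs) = xs ++ [ (x ∙ prod xs) ⁻¹ ]

  complete : List (El G) → List (El G)
  complete xs = xs ++ [ prod xs ⁻¹ ]

  complete-shift : ∀ xs → complete (shift xs) ≡ rotate (complete xs)
  complete-shift []       = refl
  complete-shift (x ∷ xs) = cong (λ z → (xs ++ [ c ]) ++ [ z ]) (begin
    prod (xs ++ [ c ]) ⁻¹          ≡⟨ cong _⁻¹ (prod-++ xs [ c ]) ⟩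
    (prod xs ∙ (c ∙ ε)) ⁻¹         ≡⟨ cong (λ z → (prod xs ∙ z) ⁻¹) (identityʳ c) ⟩
    (prod xs ∙ c) ⁻¹               ≡⟨ ⁻¹-anti-homo-∙ (prod xs) c ⟩
    (c ⁻¹) ∙ (prod xs ⁻¹)          ≡⟨ cong (_∙ (prod xs ⁻¹)) (⁻¹-involutive (x ∙ prod xs)) ⟩
    (x ∙ prod xs) ∙ (prod xs ⁻¹)   ≡⟨ assoc x _ _ ⟩
    x ∙ (prod xs ∙ (prod xs ⁻¹))   ≡⟨ cong (x ∙_) (inverseʳ (prod xs)) ⟩
    x ∙ ε                          ≡⟨ identityʳ x ⟩
    x                              ∎)
    where
    open ≡-Reasoning
    c : El G
    c = (x ∙ prod xs) ⁻¹

  complete-fold-shift : ∀ xs n → complete (fold xs shift n) ≡ fold (complete xs) rotate n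
  complete-fold-shift xs zero    = refl
  complete-fold-shift xs (suc n) = trans (complete-shift (fold xs shift n)) (cong rotate (complete-fold-shift xs n))

  fold-shift-length : ∀ xs → fold xs shift (suc (length xs)) ≡ xs
  fold-shift-length xs = ∷ʳ-injectiveˡ _ xs (begin
    complete (fold xs shift (suc (length xs)))   ≡⟨ complete-fold-shift xs (suc (length xs)) ⟩
    fold (complete xs) rotate (suc (length xs))  ≡˘⟨ cong (fold (complete xs) rotate) length-complete ⟩
    fold (complete xs) rotate (length (complete xs)) ≡⟨ fold-rotate-length (complete xs) ⟩
    complete xs                                  ∎)
    where
    open ≡-Reasoning
    length-complete : length (complete xs) ≡ suc (length xs)
    length-complete = trans (length-++ xs) (+-comm (length xs) 1)

  length-shift : ∀ xs → length (shift xs) ≡ length xs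
  length-shift []       = refl
  length-shift (x ∷ xs) = trans (length-++ xs) (+-comm (length xs) 1)

  shift-fixed⇒pow≡ε : ∀ x xs → shift (x ∷ xs) ≡ x ∷ xs →
                      xs ≡ replicate (length xs) x × pow G x (2 + length xs) ≡ ε
  shift-fixed⇒pow≡ε x xs fixed with ∷ʳ≡∷⇒replicate xs fixed
  ... | xs≡ , c≡x = xs≡ , (begin
    x ∙ (x ∙ pow G x (length xs))   ≡˘⟨ cong (λ z → x ∙ (x ∙ z)) (trans (cong prod xs≡) (prod-replicate (length xs) x)) ⟩
    x ∙ (x ∙ prod xs)               ≡˘⟨ cong (_∙ (x ∙ prod xs)) c≡x ⟩
    ((x ∙ prod xs) ⁻¹) ∙ (x ∙ prod xs) ≡⟨ inverseˡ (x ∙ prod xs) ⟩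
    ε                               ∎)
    where open ≡-Reasoning

  shift-replicate-ε : ∀ k → shift (replicate (suc k) ε) ≡ replicate (suc k) ε
  shift-replicate-ε k = trans (cong (λ z → replicate k ε ++ [ z ]) ε∙prod⁻¹≡ε) (replicate-∷ʳ k ε)
    where
    ε∙prod⁻¹≡ε : (ε ∙ prod (replicate k ε)) ⁻¹ ≡ ε
    ε∙prod⁻¹≡ε = trans (cong (λ z → (ε ∙ z) ⁻¹) (trans (prod-replicate k ε) (pow-ε k)))
                       (trans (cong _⁻¹ (identityˡ ε)) ε⁻¹≈ε)

  record IsSubgroup (H : List (El G)) : Set where
    field
      unique : Unique H
      ε-∈    : ε ∈ H
      ∙-∈    : ∀ {x y} → x ∈ H → y ∈ H → x ∙ y ∈ H
      ⁻¹-∈   : ∀ {x} → x ∈ H → x ⁻¹ ∈ H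

  module _ {H : List (El G)} (H-subgroup : IsSubgroup H) where

    open IsSubgroup H-subgroup

    prod-∈ : ∀ {xs} → All (_∈ H) xs → prod xs ∈ H
    prod-∈ []           = ε-∈
    prod-∈ (x∈ ∷ xs⊆H)  = ∙-∈ x∈ (prod-∈ xs⊆H)

    shift-⊆ : ∀ {xs} → All (_∈ H) xs → All (_∈ H) (shift xs)
    shift-⊆ []          = []
    shift-⊆ (x∈ ∷ xs⊆H) = All.++⁺ xs⊆H (⁻¹-∈ (∙-∈ x∈ (prod-∈ xs⊆H)) ∷ [])

    fixedTuple⇒element : ∀ {k xs} → xs ∈ tuples H (suc k) → shift xs ≡ xs → xs ≢ replicate (suc k) ε →
                         ∃ λ x → x ∈ H × x ≢ ε × pow G x (2 + k) ≡ ε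
    fixedTuple⇒element {k} {xs} xs∈ fixed xs≢ε⋯ε with xs | ∈-tuples⁻ {xs = H} (suc k) xs∈
    ... | x ∷ ys | length≡ , x∈H ∷ _ with shift-fixed⇒pow≡ε x ys fixed
    ...   | ys≡ , pow≡ε = x , x∈H , x≢ε , subst (λ n → pow G x (2 + n) ≡ ε) (suc-injective length≡) pow≡ε
      where
      x≢ε : x ≢ ε
      x≢ε refl = xs≢ε⋯ε (cong (ε ∷_) (trans ys≡ (cong (λ n → replicate n ε) (suc-injective length≡))))

    -- McKay: the shift permutes the k-tuples over H, k = p - 1, with period p; there
    -- are |H|^k ≡ 0 (mod p) of them, so the fixed tuples, i.e. the constant tuples
    -- (x, …, x) with x^p = ε, are also 0 mod p in number.  One of them is (ε, …, ε).
    cauchy : ∀ {p} → Prime p → p ∣ length H → ∃ λ x → x ∈ H × x ≢ ε × pow G x p ≡ ε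
    cauchy {0}             p-prime _   = ⊥-elim (¬prime[0] p-prime)
    cauchy {1}             p-prime _   = ⊥-elim (¬prime[1] p-prime)
    cauchy {suc (suc k)}   p-prime p∣H =
      let xs , xs∈F , xs≢ε⋯ε = unique-∃≢ (Unique.filter⁺ fixed? (tuples-unique unique (suc k))) ε⋯ε∈F 2≤F
          xs∈X , fixed       = ∈-filter⁻ fixed? {xs = X} xs∈F
      in  fixedTuple⇒element xs∈X fixed xs≢ε⋯ε
      where
      open FixedPoints (≡-dec _≟ᶠ_) shift p-prime
      X F : List (List (El G))
      X = tuples H (suc k)
      F = filter fixed? X
      ε⋯ε∈F : replicate (suc k) ε ∈ F
      ε⋯ε∈F = ∈-filter⁺ fixed?
        (subst (λ n → replicate (suc k) ε ∈ tuples H n) (length-replicate (suc k)) (∈-tuples⁺ (All.replicate⁺ (suc k) ε-∈)))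
        (shift-replicate-ε k)
      X-closed : Closed X
      X-closed {xs} xs∈ with ∈-tuples⁻ {xs = H} (suc k) xs∈
      ... | length≡ , xs⊆H = subst (λ n → shift xs ∈ tuples H n) (trans (length-shift xs) length≡) (∈-tuples⁺ (shift-⊆ xs⊆H))
      X-periodic : AllPeriodic X
      X-periodic {xs} xs∈ = subst (λ n → fold xs shift (suc n) ≡ xs) (proj₁ (∈-tuples⁻ {xs = H} (suc k) xs∈)) (fold-shift-length xs)
      p∣F : suc (suc k) ∣ length F
      p∣F = p∣length-fixedPoints (tuples-unique unique (suc k)) X-closed X-periodic
              (subst (suc (suc k) ∣_) (sym (length-tuples H (suc k))) (∣-trans p∣H (m∣m*n _)))
      2≤F : 2 ≤ length F
      2≤F = ≤-trans (s≤s (s≤s z≤n)) (∣⇒≤ ⦃ >-nonZero (∈-length ε⋯ε∈F) ⦄ p∣F)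

  central-∈ : ∀ {x} → IsCentral G x → x ∈ centerList G
  central-∈ {x} = ∈-filter⁺ (isCentral? G) (∈-allFin x)

  ∈-central : ∀ {x} → x ∈ centerList G → IsCentral G x
  ∈-central x∈ = proj₂ (∈-filter⁻ (isCentral? G) {xs = allFin order} x∈)

  ε-central : IsCentral G ε
  ε-central g = trans (identityˡ g) (sym (identityʳ g))

  ∙-central : ∀ {x y} → IsCentral G x → IsCentral G y → IsCentral G (x ∙ y)
  ∙-central {x} {y} x-central y-central g = begin
    (x ∙ y) ∙ g  ≡⟨ assoc x y g ⟩
    x ∙ (y ∙ g)  ≡⟨ cong (x ∙_) (y-central g) ⟩
    x ∙ (g ∙ y)  ≡˘⟨ assoc x g y ⟩
    (x ∙ g) ∙ y  ≡⟨ cong (_∙ y) (x-central g) ⟩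
    (g ∙ x) ∙ y  ≡⟨ assoc g x y ⟩
    g ∙ (x ∙ y)  ∎
    where open ≡-Reasoning

  ⁻¹-central : ∀ {x} → IsCentral G x → IsCentral G (x ⁻¹)
  ⁻¹-central {x} x-central g = begin
    (x ⁻¹) ∙ g             ≡˘⟨ cong ((x ⁻¹) ∙_) (⁻¹-involutive g) ⟩
    (x ⁻¹) ∙ ((g ⁻¹) ⁻¹)   ≡˘⟨ ⁻¹-anti-homo-∙ (g ⁻¹) x ⟩
    ((g ⁻¹) ∙ x) ⁻¹        ≡˘⟨ cong _⁻¹ (x-central (g ⁻¹)) ⟩
    (x ∙ (g ⁻¹)) ⁻¹        ≡⟨ ⁻¹-anti-homo-∙ x (g ⁻¹) ⟩
    ((g ⁻¹) ⁻¹) ∙ (x ⁻¹)   ≡⟨ cong (_∙ (x ⁻¹)) (⁻¹-involutive g) ⟩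
    g ∙ (x ⁻¹)             ∎
    where open ≡-Reasoning

  center-isSubgroup : IsSubgroup (centerList G)
  center-isSubgroup = record
    { unique = Unique.filter⁺ (isCentral? G) (Unique.allFin⁺ order)
    ; ε-∈    = central-∈ ε-central
    ; ∙-∈    = λ x∈ y∈ → central-∈ (∙-central (∈-central x∈) (∈-central y∈))
    ; ⁻¹-∈   = λ x∈ → central-∈ (⁻¹-central (∈-central x∈))
    }

  central-cauchy : ∀ {p} → Prime p → p ∣ centerOrder G → ∃ λ a → IsCentral G a × a ≢ ε × pow G a p ≡ ε
  central-cauchy p-prime p∣Z =
    let a , a∈Z , a≢ε , aᵖ≡ε = cauchy center-isSubgroup p-prime p∣Z
    in  a , ∈-central a∈Z , a≢ε , aᵖ≡ε

  _IsPowerOf_ : El G → El G → Set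
  y IsPowerOf x = ∃ λ m → y ≡ pow G x (suc m)

  isPowerOf-refl : ∀ x → x IsPowerOf x
  isPowerOf-refl x = 0 , sym (identityʳ x)

  isPowerOf-trans : ∀ {x y z} → z IsPowerOf y → y IsPowerOf x → z IsPowerOf x
  isPowerOf-trans {x} (m , refl) (n , refl) = n + m * suc n , pow-* x (suc m) (suc n)

  pow-finiteOrder : ∀ x → ∃ λ n → pow G x (suc n) ≡ ε
  pow-finiteOrder x with pigeonhole (n<1+n order) (λ i → pow G x (toℕ i))
  ... | i , j , i<j , xⁱ≡xʲ = pred d , trans (cong (pow G x) (suc-pred d ⦃ >-nonZero (m<n⇒0<n∸m i<j) ⦄)) xᵈ≡ε
    where
    d : ℕ
    d = toℕ j ∸ toℕ i
    xᵈ≡ε : pow G x d ≡ ε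
    xᵈ≡ε = identityʳ-unique (pow G x (toℕ i)) (pow G x d) (begin
      pow G x (toℕ i) ∙ pow G x d  ≡˘⟨ pow-+ x (toℕ i) d ⟩
      pow G x (toℕ i + d)          ≡⟨ cong (pow G x) (m+[n∸m]≡n (<⇒≤ i<j)) ⟩
      pow G x (toℕ j)              ≡˘⟨ xⁱ≡xʲ ⟩
      pow G x (toℕ i)              ∎)
      where open ≡-Reasoning

  -- Walking down a prime factorisation r₁ ⋯ rₙ of an exponent killing x, the last
  -- nontrivial element of x, x^r₁, x^(r₁r₂), … has prime order.
  primeOrderPower-factors : ∀ {x} → x ≢ ε → ∀ rs → All Prime rs → pow G x (product rs) ≡ ε →
                            ∃₂ λ r y → Prime r × y IsPowerOf x × y ≢ ε × pow G y r ≡ ε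
  primeOrderPower-factors x≢ε [] [] x≡ε = ⊥-elim (x≢ε (trans (sym (identityʳ _)) x≡ε))
  primeOrderPower-factors {x} x≢ε (r ∷ rs) (r-prime ∷ rs-prime) eq with pow G x r ≟ᶠ ε
  ... | yes xʳ≡ε = r , x , r-prime , isPowerOf-refl x , x≢ε , xʳ≡ε
  ... | no xʳ≢ε =
    let s , y , s-prime , y≼xʳ , y≢ε , yˢ≡ε = primeOrderPower-factors xʳ≢ε rs rs-prime xʳ-killed
    in  s , y , s-prime , isPowerOf-trans y≼xʳ xʳ≼x , y≢ε , yˢ≡ε
    where
    xʳ-killed : pow G (pow G x r) (product rs) ≡ ε
    xʳ-killed = trans (pow-* x (product rs) r) (trans (cong (pow G x) (*-comm (product rs) r)) eq)
    xʳ≼x : pow G x r IsPowerOf x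
    xʳ≼x = pred r , cong (pow G x) (sym (suc-pred r ⦃ prime⇒nonZero r-prime ⦄))

  primeOrderPower : ∀ {x} → x ≢ ε → ∃₂ λ r y → Prime r × y IsPowerOf x × y ≢ ε × pow G y r ≡ ε
  primeOrderPower {x} x≢ε =
    let n , xⁿ≡ε = pow-finiteOrder x
        open PrimeFactorisation (factorise (suc n))
    in  primeOrderPower-factors x≢ε factors factorsPrime (trans (cong (pow G x) (sym isFactorisation)) xⁿ≡ε)

  ≡ε-of-coprimeExponents : ∀ {x p q} → Prime p → Prime q → p ≢ q → pow G x p ≡ ε → pow G x q ≡ ε → x ≡ ε
  ≡ε-of-coprimeExponents {x} p-prime q-prime p≢q xᵖ≡ε x^q≡ε =
    let j , k , 1+jp≡kq = distinctPrimes-bézout p-prime q-prime p≢q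
    in  trans (sym (pow-1+multiple j xᵖ≡ε)) (trans (cong (pow G x) 1+jp≡kq) (pow-multiple k x^q≡ε))

  isPowerOf-∙ : ∀ {x y p q} → x ∙ y ≡ y ∙ x → Prime p → Prime q → p ≢ q →
                pow G x p ≡ ε → pow G y q ≡ ε → x IsPowerOf (x ∙ y)
  isPowerOf-∙ {x} {y} comm p-prime q-prime p≢q xᵖ≡ε y^q≡ε =
    let j , k , 1+jp≡kq = distinctPrimes-bézout p-prime q-prime p≢q
        open ≡-Reasoning
    in  j * _ , sym (begin
      pow G (x ∙ y) (1 + j * _)                ≡⟨ cong (pow G (x ∙ y)) 1+jp≡kq ⟩
      pow G (x ∙ y) (k * _)                    ≡⟨ pow-∙ (k * _) comm ⟩
      pow G x (k * _) ∙ pow G y (k * _)        ≡⟨ cong₂ _∙_ (cong (pow G x) (sym 1+jp≡kq)) (pow-multiple k y^q≡ε) ⟩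
      pow G x (1 + j * _) ∙ ε                  ≡⟨ identityʳ _ ⟩
      pow G x (1 + j * _)                      ≡⟨ pow-1+multiple j xᵖ≡ε ⟩
      x                                        ∎)

  delAdj : ∀ {x y z} → x ≢ ε → y ≢ ε → x ≢ y → x IsPowerOf z → y IsPowerOf z → DelAdj G x y
  delAdj x≢ε y≢ε x≢y (m , x≡) (n , y≡) = x≢ε , y≢ε , x≢y , _ , m , n , x≡ , y≡

  delAdj-commuting : ∀ {x y p q} → x ∙ y ≡ y ∙ x → Prime p → Prime q → p ≢ q → x ≢ ε → y ≢ ε →
                     pow G x p ≡ ε → pow G y q ≡ ε → DelAdj G x y
  delAdj-commuting {x} {y} comm p-prime q-prime p≢q x≢ε y≢ε xᵖ≡ε y^q≡ε = delAdj x≢ε y≢ε x≢y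
    (isPowerOf-∙ comm p-prime q-prime p≢q xᵖ≡ε y^q≡ε)
    (subst (y IsPowerOf_) (sym comm) (isPowerOf-∙ (sym comm) q-prime p-prime (≢-sym p≢q) y^q≡ε xᵖ≡ε))
    where
    x≢y : x ≢ y
    x≢y refl = x≢ε (≡ε-of-coprimeExponents p-prime q-prime p≢q xᵖ≡ε y^q≡ε)

  delAdj-sym : ∀ {x y} → DelAdj G x y → DelAdj G y x
  delAdj-sym (x≢ε , y≢ε , x≢y , z , m , n , x≡ , y≡) = y≢ε , x≢ε , ≢-sym x≢y , z , n , m , y≡ , x≡

  _▻▻_ : ∀ {x y z} → DelReach G x y → DelReach G y z → DelReach G x z
  w ▻▻ here       = w
  w ▻▻ there v a  = there (w ▻▻ v) a

  delReach-sym : ∀ {x y} → DelReach G x y → DelReach G y x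
  delReach-sym here        = here
  delReach-sym (there w a) = there here (delAdj-sym a) ▻▻ delReach-sym w

  centralPrimeOrders⇒connected :
    ∀ {p q a b} → Prime p → Prime q → p ≢ q →
    IsCentral G a → a ≢ ε → pow G a p ≡ ε → IsCentral G b → b ≢ ε → pow G b q ≡ ε →
    DeletedEPGConnected G
  centralPrimeOrders⇒connected {p} {q} {a} {b} p-prime q-prime p≢q a-central a≢ε aᵖ≡ε b-central b≢ε b^q≡ε x y x≢ε y≢ε =
    reach-a x≢ε ▻▻ delReach-sym (reach-a y≢ε)
    where
    reach-a : ∀ {x} → x ≢ ε → DelReach G x a
    reach-a {x} x≢ε with primeOrderPower x≢ε
    ... | r , y , r-prime , y≼x , y≢ε , yʳ≡ε = x⇝y ▻▻ y⇝a
      where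
      x⇝y : DelReach G x y
      x⇝y with x ≟ᶠ y
      ... | yes refl = here
      ... | no x≢y   = there here (delAdj x≢ε y≢ε x≢y (isPowerOf-refl x) y≼x)
      y⇝a : DelReach G y a
      y⇝a with r ≟ p
      ... | no r≢p   = there here (delAdj-commuting (sym (a-central y)) r-prime p-prime r≢p y≢ε a≢ε yʳ≡ε aᵖ≡ε)
      ... | yes refl = there (there here (delAdj-commuting (sym (b-central y)) r-prime q-prime p≢q y≢ε b≢ε yʳ≡ε b^q≡ε))
                             (delAdj-commuting (sym (a-central b)) q-prime p-prime (≢-sym p≢q) b≢ε a≢ε b^q≡ε aᵖ≡ε)

theorem5p2 : (G : FiniteGroup) → AtLeastTwoPrimesDivCenter G → DeletedEPGConnected G
theorem5p2 G (p , q , p-prime , q-prime , p≢q , p∣Z , q∣Z) =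
  let a , a-central , a≢ε , aᵖ≡ε = central-cauchy G p-prime p∣Z
      b , b-central , b≢ε , b^q≡ε = central-cauchy G q-prime q∣Z
  in  centralPrimeOrders⇒connected G p-prime q-prime p≢q a-central a≢ε aᵖ≡ε b-central b≢ε b^q≡ε
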